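{- Let $m\ge 2$, $n\ge 4$ and $k\ge 1$. Then $\mathrm{f}\mu^{k}(P_m\,\square\,C_n)\le\min\{2m,n\}$ if $n$ is even, and $\mathrm{f}\mu^{k}(P_m\,\square\,C_n)\le\max\{3,\min\{m,n\}\}$ if $n$ is odd.
   Context: For an integer $k\ge 0$ and a connected graph $G$, a set $X\subseteq V(G)$ is a $k$-fault-tolerant mutual-visibility set ($k$-ftmv set) if for any two non-adjacent vertices $u,v\in X$ there exist $k+1$ internally vertex-disjoint shortest $u,v$-paths $Q_1,\dots,Q_{k+1}$ in $G$ such that $V(Q_i)\cap X=\{u,v\}$ for every $i$. $\mathrm{f}\mu^{k}(G)$ denotes the maximum cardinality of a $k$-ftmv set of $G$. $P_m$ is the path on $m$ vertices, $C_n$ the cycle on $n$ vertices, and $G\,\square\,H$ is the Cartesian product: vertex set $V(G)\times V(H)$, with $(g,h)\sim(g',h')$ iff either $g=g'$ and $hh'\in E(H)$, or $gg'\in E(G)$ and $h=h'$. -}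

module Defs where

open import Data.Nat using (ℕ; zero; suc; _≤_)
open import Data.Fin using (Fin; toℕ)
open import Data.Product using (Σ; _×_; _,_)
open import Data.Sum using (_⊎_)
open import Data.List using (List; []; _∷_)
open import Data.List.Membership.Propositional using (_∈_; _∉_)
open import Relation.Nullary using (¬_)
open import Relation.Binary.PropositionalEquality using (_≡_; _≢_)

module _ {V : Set} (E : V → V → Set) where

  data Walk : V → V → Set where
    [_]  : (u : V) → Walk u u
    step : {u w v : V} → E u w → Walk w v → Walk u v

  len : {u v : V} → Walk u v → ℕ
  len [ _ ]      = 0
  len (step _ p) = suc (len p)

  initVerts : {u v : V} → Walk u v → List V
  initVerts [ _ ]              = []
  initVerts (step {u} _ p)     = u ∷ initVerts p

  interior : {u v : V} → Walk u v → List V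
  interior [ _ ]      = []
  interior (step _ p) = initVerts p

  -- A shortest u,v-path: a u,v-walk of minimum length among all u,v-walks
  -- (such a walk is automatically a path).
  IsShortest : {u v : V} → Walk u v → Set
  IsShortest {u} {v} p = (q : Walk u v) → len p ≤ len q

  IsFTMV : ℕ → List V → Set
  IsFTMV k X =
    (u v : V) → u ∈ X → v ∈ X → u ≢ v → ¬ E u v →
    Σ (Fin (suc k) → Walk u v) λ Q →
      ((i : Fin (suc k)) → IsShortest (Q i)) ×
      ((i j : Fin (suc k)) → i ≢ j → (w : V) → w ∈ interior (Q i) → w ∉ interior (Q j)) ×
      ((i : Fin (suc k)) → (w : V) → w ∈ interior (Q i) → w ∉ X)

PathAdj : (m : ℕ) → Fin m → Fin m → Set
PathAdj m i j = suc (toℕ i) ≡ toℕ j ⊎ suc (toℕ j) ≡ toℕ i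

CycSucc : (n : ℕ) → Fin n → Fin n → Set
CycSucc n i j = suc (toℕ i) ≡ toℕ j ⊎ (suc (toℕ i) ≡ n × toℕ j ≡ 0)

CycleAdj : (n : ℕ) → Fin n → Fin n → Set
CycleAdj n i j = CycSucc n i j ⊎ CycSucc n j i

BoxAdj : {A B : Set} → (A → A → Set) → (B → B → Set) → A × B → A × B → Set
BoxAdj G H (g , h) (g' , h') = (g ≡ g' × H h h') ⊎ (G g g' × h ≡ h')

PCAdj : (m n : ℕ) → Fin m × Fin n → Fin m × Fin n → Set
PCAdj m n = BoxAdj (PathAdj m) (CycleAdj n)

{-# OPTIONS --safe #-}
-- Write a vertex of P_m □ C_n as (i , a), with i on the path and a on the cycle; row i is {i} × C_n
-- and column a is P_m × {a}. The distance from (i , a) to (p , b) is |i − p| plus the distance of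
-- a and b in C_n, so the second vertex of a shortest path is a neighbour strictly closer to the
-- target. As k ≥ 1, two internally disjoint shortest paths leave any u ∈ X towards any
-- non-adjacent v ∈ X through two distinct such neighbours outside X. At most one of them stays in
-- the column of u, so if the closer column neighbour of u is in X (or does not exist), both move
-- along the cycle, one forwards and one backwards, which puts v in the column antipodal to u's.
-- Hence two vertices of X in a column are adjacent, two in a row are cycle-adjacent or antipodal,
-- and (n ≥ 4) no row or column holds three of them, so |X| ≤ 2m. If some column holds two, every
-- other vertex of X lies in the antipodal column and |X| ≤ 4 ≤ n; otherwise |X| ≤ n. For odd n
-- there are no antipodes: a column with two vertices contains all of X; a row with two vertices,
-- necessarily (i , a) and (i , a + 1), puts every other vertex in the column at offset (n − 1)/2
-- from a + 1, so |X| ≤ 3; and if no row or column holds two, |X| ≤ min(m, n).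
module Submission where

open import Defs
open import Data.Nat using (ℕ; _≤_; _*_; _⊓_; _⊔_; _%_)
open import Data.Fin using (Fin)
open import Data.Product using (_×_)
open import Data.List using (List; length)
open import Data.List.Relation.Unary.Unique.Propositional using (Unique)
open import Relation.Binary.PropositionalEquality using (_≡_)

open import Data.Nat
open import Data.Nat.Properties
open import Data.Nat.DivMod using (_/_; m≡m%n+[m/n]*n)
open import Data.Fin as Fin using (fromℕ; fromℕ<; inject₁; toℕ)
open import Data.Fin.Properties using (toℕ<n; toℕ-injective; toℕ-fromℕ; toℕ-fromℕ<; toℕ-inject₁)
open import Data.Product using (_,_; proj₁; proj₂; ∃; ∃₂; Σ)
open import Data.Product.Properties using (≡-dec)
open import Data.Sum using (_⊎_; inj₁; inj₂)
open import Data.Empty using (⊥)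
open import Data.List using ([]; _∷_; filter)
open import Data.List.Membership.Propositional using (_∈_; _∉_; find; lose)
open import Data.List.Membership.Propositional.Properties using (∈-filter⁻)
open import Data.List.Relation.Unary.All as All using (All; []; _∷_)
open import Data.List.Relation.Unary.All.Properties using (all-filter) renaming (filter⁺ to All-filter⁺)
open import Data.List.Relation.Unary.Any using (here; any?)
open import Data.List.Relation.Unary.AllPairs using (_∷_)
import Data.List.Relation.Unary.Unique.Propositional.Properties as Unique
open import Data.List.Relation.Binary.Sublist.Propositional.Properties using (filter⁺; filter-⊆; length-mono-≤)
open import Function.Base using (_∘_)
open import Function.Bundles using (_⇔_; mk⇔; Equivalence)
open import Relation.Binary using (tri<; tri≈; tri>)
open import Relation.Binary.Definitions using (DecidableEquality)
open import Relation.Binary.PropositionalEquality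
open import Relation.Nullary using (¬_; Dec; contradiction; yes; no)
open import Relation.Nullary.Decidable using (_⊎-dec_; _×-dec_; ¬?; decidable-stable)
open import Relation.Unary using (Decidable)
open import Relation.Unary.Properties using (∁?)

-- Adjacency in C_n and P_m

-- On toℕ, CycSucc n, CycleAdj n and PathAdj m of Defs unfold to Succ n, CycAdj n and Consecutive.
Succ : ℕ → ℕ → ℕ → Set
Succ n x y = suc x ≡ y ⊎ (suc x ≡ n × y ≡ 0)

succ-3-cycle⇒n≤3 : ∀ {n a b c} → Succ n a b → Succ n b c → Succ n c a → n ≤ 3
succ-3-cycle⇒n≤3 (inj₁ refl) (inj₁ refl) (inj₁ ())
succ-3-cycle⇒n≤3 (inj₁ refl) (inj₁ refl) (inj₂ (refl , refl)) = ≤-refl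
succ-3-cycle⇒n≤3 (inj₁ refl) (inj₂ (refl , refl)) (inj₁ refl) = ≤-refl
succ-3-cycle⇒n≤3 (inj₂ (refl , refl)) (inj₁ refl) (inj₁ refl) = ≤-refl
succ-3-cycle⇒n≤3 (inj₁ refl) (inj₂ (refl , refl)) (inj₂ (() , _))
succ-3-cycle⇒n≤3 (inj₂ (refl , refl)) (inj₁ refl) (inj₂ (() , refl))
succ-3-cycle⇒n≤3 (inj₂ (refl , refl)) (inj₂ (refl , refl)) _ = s≤s z≤n

succ-functional : ∀ {n x y₁ y₂} → y₁ < n → y₂ < n → Succ n x y₁ → Succ n x y₂ → y₁ ≡ y₂
succ-functional _   _   (inj₁ refl)      (inj₁ refl)      = refl
succ-functional y<n _   (inj₁ refl)      (inj₂ (refl , _)) = contradiction y<n (<-irrefl refl)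
succ-functional _   y<n (inj₂ (refl , _)) (inj₁ refl)      = contradiction y<n (<-irrefl refl)
succ-functional _   _   (inj₂ (_ , refl)) (inj₂ (_ , refl)) = refl

succ-injective : ∀ {n x₁ x₂ y} → Succ n x₁ y → Succ n x₂ y → x₁ ≡ x₂
succ-injective (inj₁ refl)       (inj₁ e)          = suc-injective (sym e)
succ-injective (inj₁ refl)       (inj₂ (_ , ()))
succ-injective (inj₂ (_ , refl)) (inj₁ ())
succ-injective (inj₂ (e₁ , _))   (inj₂ (e₂ , _))   = suc-injective (trans e₁ (sym e₂))

succ-irreflexive : ∀ {n x} → Succ n x x → n ≤ 1
succ-irreflexive (inj₂ (refl , refl)) = ≤-refl

CycAdj : ℕ → ℕ → ℕ → Set
CycAdj n x y = Succ n x y ⊎ Succ n y x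

cycAdj-triangle⇒n≤3 : ∀ {n a b c} → a < n → b < n → c < n →
                      CycAdj n a b → CycAdj n b c → CycAdj n a c → n ≤ 3
cycAdj-triangle⇒n≤3 {n} {a} {b} {c} a<n b<n c<n = triangle
  where
  -- Unless the triangle is a 3-cycle of successors, some vertex has two successors, which coincide.
  self-loop : ∀ {x} → Succ n x x → n ≤ 3
  self-loop s = ≤-trans (succ-irreflexive s) (s≤s z≤n)

  triangle : CycAdj n a b → CycAdj n b c → CycAdj n a c → n ≤ 3
  triangle (inj₁ ab) (inj₁ bc) (inj₂ ca) = succ-3-cycle⇒n≤3 ab bc ca
  triangle (inj₂ ba) (inj₂ cb) (inj₁ ac) = succ-3-cycle⇒n≤3 ac cb ba
  triangle (inj₁ ab) (inj₁ bc) (inj₁ ac) = self-loop (subst (λ x → Succ n x c) (succ-functional b<n c<n ab ac) bc)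
  triangle (inj₁ ab) (inj₂ cb) (inj₁ ac) = self-loop (subst (Succ n c) (succ-functional b<n c<n ab ac) cb)
  triangle (inj₁ ab) (inj₂ cb) (inj₂ ca) = self-loop (subst (Succ n a) (succ-functional b<n a<n cb ca) ab)
  triangle (inj₂ ba) (inj₁ bc) (inj₁ ac) = self-loop (subst (Succ n a) (succ-functional c<n a<n bc ba) ac)
  triangle (inj₂ ba) (inj₁ bc) (inj₂ ca) = self-loop (subst (Succ n c) (succ-functional a<n c<n ba bc) ca)
  triangle (inj₂ ba) (inj₂ cb) (inj₂ ca) = self-loop (subst (Succ n b) (succ-functional a<n b<n ca cb) ba)

succ? : ∀ n x y → Dec (Succ n x y)
succ? n x y = (suc x ≟ y) ⊎-dec ((suc x ≟ n) ×-dec (y ≟ 0))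

cycAdj? : ∀ n x y → Dec (CycAdj n x y)
cycAdj? n x y = succ? n x y ⊎-dec succ? n y x

cycAdj-sym : ∀ {n x y} → CycAdj n x y → CycAdj n y x
cycAdj-sym (inj₁ s) = inj₂ s
cycAdj-sym (inj₂ s) = inj₁ s

Consecutive : ℕ → ℕ → Set
Consecutive x y = suc x ≡ y ⊎ suc y ≡ x

consecutive-triangle : ∀ {a b c} → Consecutive a b → Consecutive b c → Consecutive a c → ⊥
consecutive-triangle (inj₁ refl) (inj₁ refl) (inj₁ ())
consecutive-triangle (inj₁ refl) (inj₁ refl) (inj₂ ())
consecutive-triangle (inj₁ refl) (inj₂ refl) (inj₁ ())
consecutive-triangle (inj₁ refl) (inj₂ refl) (inj₂ ())
consecutive-triangle (inj₂ refl) (inj₁ refl) (inj₁ ())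
consecutive-triangle (inj₂ refl) (inj₁ refl) (inj₂ ())
consecutive-triangle (inj₂ refl) (inj₂ refl) (inj₁ ())
consecutive-triangle (inj₂ refl) (inj₂ refl) (inj₂ ())

consecutive-sym : ∀ {x y} → Consecutive x y → Consecutive y x
consecutive-sym (inj₁ e) = inj₂ e
consecutive-sym (inj₂ e) = inj₁ e

consecutive-irrefl : ∀ {x} → ¬ Consecutive x x
consecutive-irrefl (inj₁ e) = 1+n≢n e
consecutive-irrefl (inj₂ e) = 1+n≢n e

consecutive? : ∀ x y → Dec (Consecutive x y)
consecutive? x y = (suc x ≟ y) ⊎-dec (suc y ≟ x)

∣m-[1+m]∣≡1 : ∀ m → ∣ m - suc m ∣ ≡ 1
∣m-[1+m]∣≡1 zero    = refl
∣m-[1+m]∣≡1 (suc m) = ∣m-[1+m]∣≡1 m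

∣-∣-consecutive : ∀ {x y} p → Consecutive x y → ∣ x - p ∣ ≤ suc ∣ y - p ∣
∣-∣-consecutive {x} p (inj₁ refl) =
  subst (λ d → ∣ x - p ∣ ≤ d + ∣ suc x - p ∣) (∣m-[1+m]∣≡1 x) (∣-∣-triangle x (suc x) p)
∣-∣-consecutive {y = y} p (inj₂ refl) =
  subst (λ d → ∣ suc y - p ∣ ≤ d + ∣ y - p ∣) (trans (∣-∣-comm (suc y) y) (∣m-[1+m]∣≡1 y))
        (∣-∣-triangle (suc y) y p)

m<n⇒∣1+m-n∣<∣m-n∣ : ∀ {m n} → m < n → ∣ suc m - n ∣ < ∣ m - n ∣
m<n⇒∣1+m-n∣<∣m-n∣ {zero}  {suc n} _         = ≤-refl
m<n⇒∣1+m-n∣<∣m-n∣ {suc m} {suc n} (s≤s m<n) = m<n⇒∣1+m-n∣<∣m-n∣ m<n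

n≤m⇒∣m-n∣<∣1+m-n∣ : ∀ {m n} → n ≤ m → ∣ m - n ∣ < ∣ suc m - n ∣
n≤m⇒∣m-n∣<∣1+m-n∣ {zero}  {zero}  _         = ≤-refl
n≤m⇒∣m-n∣<∣1+m-n∣ {suc m} {zero}  _         = ≤-refl
n≤m⇒∣m-n∣<∣1+m-n∣ {suc m} {suc n} (s≤s n≤m) = n≤m⇒∣m-n∣<∣1+m-n∣ n≤m

∣1+m-n∣<∣m-n∣⇒m<n : ∀ {m n} → ∣ suc m - n ∣ < ∣ m - n ∣ → m < n
∣1+m-n∣<∣m-n∣⇒m<n {m} {n} closer with m <? n
... | yes m<n = m<n
... | no  m≮n = contradiction closer (<-asym (n≤m⇒∣m-n∣<∣1+m-n∣ (≮⇒≥ m≮n)))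

∣m-n∣<∣1+m-n∣⇒n≤m : ∀ {m n} → ∣ m - n ∣ < ∣ suc m - n ∣ → n ≤ m
∣m-n∣<∣1+m-n∣⇒n≤m {m} {n} farther with m <? n
... | yes m<n = contradiction farther (<-asym (m<n⇒∣1+m-n∣<∣m-n∣ m<n))
... | no  m≮n = ≮⇒≥ m≮n

consecutive-closer-unique : ∀ {x y₁ y₂} p → Consecutive x y₁ → Consecutive x y₂ →
                            ∣ y₁ - p ∣ < ∣ x - p ∣ → ∣ y₂ - p ∣ < ∣ x - p ∣ → y₁ ≡ y₂
consecutive-closer-unique p (inj₁ refl) (inj₁ refl) _ _ = refl
consecutive-closer-unique p (inj₂ refl) (inj₂ e)    _ _ = suc-injective (sym e)
consecutive-closer-unique {x} {_} {y} p (inj₁ refl) (inj₂ refl) up down =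
  contradiction (<-trans (∣1+m-n∣<∣m-n∣⇒m<n {x} up) (s≤s (∣m-n∣<∣1+m-n∣⇒n≤m {y} down))) (<-irrefl refl)
consecutive-closer-unique {x} {y} p (inj₂ refl) (inj₁ refl) down up =
  contradiction (<-trans (∣1+m-n∣<∣m-n∣⇒m<n {x} up) (s≤s (∣m-n∣<∣1+m-n∣⇒n≤m {y} down))) (<-irrefl refl)

consecutive-closer-or-farther : ∀ {x y} p → Consecutive x y → ∣ y - p ∣ < ∣ x - p ∣ ⊎ ∣ x - p ∣ < ∣ y - p ∣
consecutive-closer-or-farther {x} p (inj₁ refl) with x <? p
... | yes x<p = inj₁ (m<n⇒∣1+m-n∣<∣m-n∣ x<p)
... | no  x≮p = inj₂ (n≤m⇒∣m-n∣<∣1+m-n∣ (≮⇒≥ x≮p))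
consecutive-closer-or-farther {y = y} p (inj₂ refl) with y <? p
... | yes y<p = inj₂ (m<n⇒∣1+m-n∣<∣m-n∣ y<p)
... | no  y≮p = inj₁ (n≤m⇒∣m-n∣<∣1+m-n∣ (≮⇒≥ y≮p))

-- Offsets and distances in C_n

-- (b − a) mod n, for a, b < n.
offset : ℕ → ℕ → ℕ → ℕ
offset n zero    b       = b
offset n (suc a) zero    = n ∸ suc a
offset n (suc a) (suc b) = offset n a b

offset-self : ∀ n a → offset n a a ≡ 0
offset-self n zero    = refl
offset-self n (suc a) = offset-self n a

offset-≤ : ∀ n {a b} → a ≤ b → offset n a b ≡ b ∸ a
offset-≤ n {zero}  _         = refl
offset-≤ n {suc a} (s≤s a≤b) = offset-≤ n a≤b

1+[n∸[1+m]]≡n∸m : ∀ {m n} → m < n → suc (n ∸ suc m) ≡ n ∸ m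
1+[n∸[1+m]]≡n∸m m<n = sym (+-∸-assoc 1 m<n)

offset-> : ∀ {n a b} → b < a → a ≤ n → offset n a b ≡ n ∸ a + b
offset-> {n} {suc a} {zero}  _         _   = sym (+-identityʳ (n ∸ suc a))
offset-> {n} {suc a} {suc b} (s≤s b<a) a<n = begin
  offset n a b          ≡⟨ offset-> b<a (<⇒≤ a<n) ⟩
  n ∸ a + b             ≡⟨ cong (_+ b) (1+[n∸[1+m]]≡n∸m a<n) ⟨
  suc (n ∸ suc a) + b   ≡⟨ +-suc (n ∸ suc a) b ⟨
  n ∸ suc a + suc b     ∎
  where open ≡-Reasoning

offset<n∸a : ∀ {n a b} → a ≤ b → b < n → offset n a b < n ∸ a
offset<n∸a {n} {a} a≤b b<n = subst (_< n ∸ a) (sym (offset-≤ n a≤b)) (∸-monoˡ-< b<n a≤b)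

n∸a≤offset : ∀ {n a b} → b < a → a ≤ n → n ∸ a ≤ offset n a b
n∸a≤offset {n} {a} {b} b<a a≤n = subst (n ∸ a ≤_) (sym (offset-> b<a a≤n)) (m≤m+n (n ∸ a) b)

offset<n : ∀ {n a b} → a < n → b < n → offset n a b < n
offset<n {n} {a} {b} a<n b<n with a ≤? b
... | yes a≤b = <-≤-trans (offset<n∸a a≤b b<n) (m∸n≤m n a)
... | no  a≰b = begin-strict
  offset n a b  ≡⟨ offset-> (≰⇒> a≰b) (<⇒≤ a<n) ⟩
  n ∸ a + b     <⟨ +-monoʳ-< (n ∸ a) (≰⇒> a≰b) ⟩
  n ∸ a + a     ≡⟨ m∸n+n≡m (<⇒≤ a<n) ⟩
  n             ∎
  where open ≤-Reasoning

offset-injective : ∀ {n a b c} → a < n → b < n → c < n → offset n a b ≡ offset n a c → b ≡ c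
offset-injective {n} {a} {b} {c} a<n b<n c<n eq with a ≤? b | a ≤? c
... | yes a≤b | yes a≤c = ∸-cancelʳ-≡ a≤b a≤c (trans (sym (offset-≤ n a≤b)) (trans eq (offset-≤ n a≤c)))
... | yes a≤b | no  a≰c = contradiction (subst (_< n ∸ a) eq (offset<n∸a a≤b b<n))
                                        (≤⇒≯ (n∸a≤offset (≰⇒> a≰c) (<⇒≤ a<n)))
... | no  a≰b | yes a≤c = contradiction (subst (_< n ∸ a) (sym eq) (offset<n∸a a≤c c<n))
                                        (≤⇒≯ (n∸a≤offset (≰⇒> a≰b) (<⇒≤ a<n)))
... | no  a≰b | no  a≰c = +-cancelˡ-≡ (n ∸ a) b c
  (trans (sym (offset-> (≰⇒> a≰b) (<⇒≤ a<n))) (trans eq (offset-> (≰⇒> a≰c) (<⇒≤ a<n))))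

offset≡0⇒≡ : ∀ {n a b} → a < n → b < n → offset n a b ≡ 0 → a ≡ b
offset≡0⇒≡ {n} {a} a<n b<n eq = offset-injective a<n a<n b<n (trans (offset-self n a) (sym eq))

offset-stepˡ : ∀ {n a b} → suc a < n → Succ n (offset n (suc a) b) (offset n a b)
offset-stepˡ {n} {zero}  {zero}  1<n = inj₂ (m+[n∸m]≡n (<⇒≤ 1<n) , refl)
offset-stepˡ {n} {zero}  {suc b} _   = inj₁ refl
offset-stepˡ {n} {suc a} {zero}  a<n = inj₁ (1+[n∸[1+m]]≡n∸m (<⇒≤ a<n))
offset-stepˡ {n} {suc a} {suc b} a<n = offset-stepˡ {n} {a} {b} (<-trans (n<1+n (suc a)) a<n)

offset-wrapˡ : ∀ {n a b} → suc a ≡ n → b < n → Succ n b (offset n a b)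
offset-wrapˡ {n} {a} {b} refl b<n with <-cmp b a
... | tri< b<a _ _ = inj₁ (sym (trans (offset-> b<a (n≤1+n a)) (cong (_+ b) (m+n∸n≡m 1 a))))
... | tri≈ _ refl _ = inj₂ (refl , offset-self n b)
... | tri> _ _ a<b = contradiction b<n (≤⇒≯ a<b)

offset-succˡ : ∀ {n a a' b} → a' < n → b < n → Succ n a a' → Succ n (offset n a' b) (offset n a b)
offset-succˡ a'<n _   (inj₁ refl)      = offset-stepˡ a'<n
offset-succˡ _    b<n (inj₂ (e , refl)) = offset-wrapˡ e b<n

m⊓[1+n]≤1+[[1+m]⊓n] : ∀ m n → m ⊓ suc n ≤ suc (suc m ⊓ n)
m⊓[1+n]≤1+[[1+m]⊓n] m n = ⊓-mono-≤ (≤-trans (n≤1+n m) (n≤1+n (suc m))) (≤-refl {suc n})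

[1+m]⊓n≤1+[m⊓[1+n]] : ∀ m n → suc m ⊓ n ≤ suc (m ⊓ suc n)
[1+m]⊓n≤1+[m⊓[1+n]] m n = ⊓-mono-≤ (≤-refl {suc m}) (≤-trans (n≤1+n n) (n≤1+n (suc n)))

m⊓[1+n]<[1+m]⊓n⇔m<n : ∀ m n → (m ⊓ suc n < suc m ⊓ n) ⇔ (m < n)
m⊓[1+n]<[1+m]⊓n⇔m<n m n = mk⇔ to from
  where
  to : m ⊓ suc n < suc m ⊓ n → m < n
  to lt with m <? n
  ... | yes m<n = m<n
  ... | no  m≮n = contradiction (<-≤-trans lt (m⊓n≤n (suc m) n))
                    (≤⇒≯ (⊓-glb (≮⇒≥ m≮n) (n≤1+n n)))
  from : m < n → m ⊓ suc n < suc m ⊓ n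
  from m<n = subst (m ⊓ suc n <_) (sym (m≤n⇒m⊓n≡m m<n)) (s≤s (m⊓n≤m m (suc n)))

-- cyclicNorm n (offset n a b) is the distance from a to b in C_n.
cyclicNorm : ℕ → ℕ → ℕ
cyclicNorm n t = t ⊓ (n ∸ t)

cyclicNorm-unfold : ∀ {n x} → x < n → cyclicNorm n x ≡ x ⊓ suc (n ∸ suc x)
cyclicNorm-unfold {x = x} x<n = cong (x ⊓_) (sym (1+[n∸[1+m]]≡n∸m x<n))

cyclicNorm-succ≤ : ∀ {n x y} → y < n → Succ n x y → cyclicNorm n y ≤ suc (cyclicNorm n x)
cyclicNorm-succ≤ {n} {x} y<n (inj₁ refl) rewrite cyclicNorm-unfold {n} {x} (<⇒≤ y<n) =
  [1+m]⊓n≤1+[m⊓[1+n]] x (n ∸ suc x)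
cyclicNorm-succ≤ _ (inj₂ (_ , refl)) = z≤n

cyclicNorm-pred≤ : ∀ {n x y} → y < n → Succ n x y → cyclicNorm n x ≤ suc (cyclicNorm n y)
cyclicNorm-pred≤ {n} {x} y<n (inj₁ refl) rewrite cyclicNorm-unfold {n} {x} (<⇒≤ y<n) =
  m⊓[1+n]≤1+[[1+m]⊓n] x (n ∸ suc x)
cyclicNorm-pred≤ {x = x} _ (inj₂ (refl , refl)) =
  ≤-trans (m⊓n≤n x (suc x ∸ x)) (≤-reflexive (m+n∸n≡m 1 x))

cyclicNorm-pred<⇔ : ∀ {n x y} → y < n → Succ n x y →
                    (cyclicNorm n x < cyclicNorm n y) ⇔ (0 < y × y ≤ n ∸ y)
cyclicNorm-pred<⇔ {n} {x} y<n (inj₁ refl) rewrite cyclicNorm-unfold {n} {x} (<⇒≤ y<n) =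
  mk⇔ (λ lt → z<s , Equivalence.to core lt) (λ (_ , x<r) → Equivalence.from core x<r)
  where core = m⊓[1+n]<[1+m]⊓n⇔m<n x (n ∸ suc x)
cyclicNorm-pred<⇔ _ (inj₂ (_ , refl)) = mk⇔ (λ ()) (λ ())

cyclicNorm-succ<⇔ : ∀ {n x y} → y < n → Succ n x y → (cyclicNorm n y < cyclicNorm n x) ⇔ (n ∸ x ≤ x)
cyclicNorm-succ<⇔ {n} {x} y<n (inj₁ refl)
  rewrite sym (1+[n∸[1+m]]≡n∸m {x} {n} (<⇒≤ y<n))
        | ⊓-comm (suc x) (n ∸ suc x) | ⊓-comm x (suc (n ∸ suc x)) = m⊓[1+n]<[1+m]⊓n⇔m<n (n ∸ suc x) x
cyclicNorm-succ<⇔ {x = x} _ (inj₂ (refl , refl)) rewrite m+n∸n≡m 1 x = wrap x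
  where
  wrap : ∀ x → (0 < x ⊓ 1) ⇔ (1 ≤ x)
  wrap zero    = mk⇔ (λ ()) (λ ())
  wrap (suc x) = mk⇔ (λ _ → s≤s z≤n) (λ _ → s≤s z≤n)

halves⇒2*t≡n : ∀ {n t} → t ≤ n → t ≤ n ∸ t → n ∸ t ≤ t → 2 * t ≡ n
halves⇒2*t≡n {n} {t} t≤n t≤n∸t n∸t≤t = begin
  t + (t + 0)   ≡⟨ cong (t +_) (+-identityʳ t) ⟩
  t + t         ≡⟨ cong (t +_) (≤-antisym t≤n∸t n∸t≤t) ⟩
  t + (n ∸ t)   ≡⟨ m+[n∸m]≡n t≤n ⟩
  n             ∎
  where open ≡-Reasoning

odd⇒≡1+2*[n/2] : ∀ {n} → n % 2 ≡ 1 → n ≡ suc (2 * (n / 2))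
odd⇒≡1+2*[n/2] {n} odd = trans (m≡m%n+[m/n]*n n 2) (cong₂ _+_ odd (*-comm (n / 2) 2))

odd⇒2*m≢n : ∀ {n} m → n % 2 ≡ 1 → 2 * m ≢ n
odd⇒2*m≢n {n} m odd eq = even≢odd m (n / 2) (trans eq (odd⇒≡1+2*[n/2] odd))

odd-middle : ∀ {n t} → n % 2 ≡ 1 → t ≤ n → t ≤ n ∸ t → n ∸ suc t ≤ suc t → suc (2 * t) ≡ n
odd-middle {n} {t} odd t≤n t≤n∸t n∸1+t≤1+t =
  trans (cong (suc ∘ (2 *_)) t≡h) (sym n≡1+2h)
  where
  h = n / 2
  n≡1+2h : n ≡ suc (2 * h)
  n≡1+2h = odd⇒≡1+2*[n/2] odd
  2t≤n : 2 * t ≤ n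
  2t≤n = subst (_≤ n) (cong (t +_) (sym (+-identityʳ t))) (m≤o∸n⇒m+n≤o t t≤n t≤n∸t)
  n≤2[1+t] : n ≤ 2 * suc t
  n≤2[1+t] = begin
    n                          ≤⟨ m≤n+m∸n n (suc t) ⟩
    suc t + (n ∸ suc t)        ≤⟨ +-monoʳ-≤ (suc t) n∸1+t≤1+t ⟩
    suc t + suc t              ≡⟨ cong (suc t +_) (+-identityʳ (suc t)) ⟨
    2 * suc t                  ∎
    where open ≤-Reasoning
  t≤h : t ≤ h
  t≤h = s≤s⁻¹ (*-cancelˡ-< 2 t (suc h) (begin-strict
    2 * t              ≤⟨ 2t≤n ⟩
    n                  ≡⟨ n≡1+2h ⟩
    suc (2 * h)        <⟨ n<1+n _ ⟩
    suc (suc (2 * h))  ≡⟨ *-suc 2 h ⟨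
    2 * suc h          ∎))
    where open ≤-Reasoning
  h≤t : h ≤ t
  h≤t = s≤s⁻¹ (*-cancelˡ-< 2 h (suc t) (subst (_≤ 2 * suc t) n≡1+2h n≤2[1+t]))
  t≡h : t ≡ h
  t≡h = ≤-antisym t≤h h≤t

-- Counting by fibres

module _ {A : Set} where

  AtMostTwo : (A → Set) → Set
  AtMostTwo P = ∀ {x y z} → P x → P y → P z → x ≢ y → y ≢ z → x ≢ z → ⊥

  atMostTwo-pair : ∀ {Q : A → Set} {u u'} → AtMostTwo (λ x → Q x × (x ≡ u ⊎ x ≡ u'))
  atMostTwo-pair (_ , inj₁ refl) (_ , inj₁ refl) _               x≢y _   _   = x≢y refl
  atMostTwo-pair (_ , inj₂ refl) (_ , inj₂ refl) _               x≢y _   _   = x≢y refl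
  atMostTwo-pair (_ , inj₁ refl) (_ , inj₂ refl) (_ , inj₁ refl) _   _   x≢z = x≢z refl
  atMostTwo-pair (_ , inj₁ refl) (_ , inj₂ refl) (_ , inj₂ refl) _   y≢z _   = y≢z refl
  atMostTwo-pair (_ , inj₂ refl) (_ , inj₁ refl) (_ , inj₁ refl) _   y≢z _   = y≢z refl
  atMostTwo-pair (_ , inj₂ refl) (_ , inj₁ refl) (_ , inj₂ refl) _   _   x≢z = x≢z refl

  length≤1 : ∀ {P : A → Set} {xs} → Unique xs → All P xs → (∀ {x y} → P x → P y → x ≡ y) → length xs ≤ 1
  length≤1 {xs = []}         _                _                    _   = z≤n
  length≤1 {xs = _ ∷ []}     _                _                    _   = ≤-refl
  length≤1 {xs = _ ∷ _ ∷ _}  ((x≢y ∷ _) ∷ _)  (px ∷ py ∷ _)        one = contradiction (one px py) x≢y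

  length≤2 : ∀ {P : A → Set} {xs} → Unique xs → All P xs → AtMostTwo P → length xs ≤ 2
  length≤2 {xs = []}             _                                  _ _ = z≤n
  length≤2 {xs = _ ∷ []}         _                                  _ _ = s≤s z≤n
  length≤2 {xs = _ ∷ _ ∷ []}     _                                  _ _ = ≤-refl
  length≤2 {xs = _ ∷ _ ∷ _ ∷ _}  ((x≢y ∷ x≢z ∷ _) ∷ (y≢z ∷ _) ∷ _)  (px ∷ py ∷ pz ∷ _) two =
    contradiction (two px py pz x≢y y≢z x≢z) λ ()

  module _ {P : A → Set} (P? : Decidable P) where

    length-filter+∁ : ∀ xs → length (filter P? xs) + length (filter (∁? P?) xs) ≡ length xs
    length-filter+∁ []       = refl
    length-filter+∁ (x ∷ xs) with P? x
    ... | yes _ = cong suc (length-filter+∁ xs)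
    ... | no  _ = trans (+-suc _ _) (cong suc (length-filter+∁ xs))

    length≤-split : ∀ {a b} xs → length (filter P? xs) ≤ a → length (filter (∁? P?) xs) ≤ b → length xs ≤ a + b
    length≤-split xs ≤a ≤b = subst (_≤ _) (length-filter+∁ xs) (+-mono-≤ ≤a ≤b)

    filter-members : ∀ xs → All (λ x → x ∈ xs × P x) (filter P? xs)
    filter-members xs = All.tabulate (∈-filter⁻ P?)

    filter-length≤1 : ∀ {xs} → Unique xs → (∀ {x y} → x ∈ xs × P x → y ∈ xs × P y → x ≡ y) →
                      length (filter P? xs) ≤ 1
    filter-length≤1 {xs} unique = length≤1 (Unique.filter⁺ P? unique) (filter-members xs)

    filter-length≤2 : ∀ {xs} → Unique xs → AtMostTwo (λ x → x ∈ xs × P x) → length (filter P? xs) ≤ 2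
    filter-length≤2 {xs} unique = length≤2 (Unique.filter⁺ P? unique) (filter-members xs)

  module _ (f : A → ℕ) where

    fibre : ℕ → List A → List A
    fibre i = filter (λ x → f x ≟ i)

    length≤fibres : ∀ M c xs → All (λ x → f x < M) xs → (∀ i → length (fibre i xs) ≤ c) → length xs ≤ M * c
    length≤fibres zero    c []       _          _ = z≤n
    length≤fibres zero    c (_ ∷ _)  (() ∷ _)   _
    length≤fibres (suc M) c xs bound fibres =
      length≤-split (λ x → f x ≟ M) xs (fibres M) (length≤fibres M c rest rest<M rest-fibres)
      where
      rest = filter (∁? (λ x → f x ≟ M)) xs
      rest<M : All (λ x → f x < M) rest
      rest<M = All.zipWith (λ (lt , ne) → ≤∧≢⇒< (s≤s⁻¹ lt) ne)
                           (All-filter⁺ (∁? (λ x → f x ≟ M)) bound , all-filter _ xs)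
      rest-fibres : ∀ i → length (fibre i rest) ≤ c
      rest-fibres i = ≤-trans (length-mono-≤ (filter⁺ _ _ (λ { refl p → p }) (filter-⊆ _ xs))) (fibres i)

    InjectiveOn : List A → Set
    InjectiveOn xs = ∀ {x y} → x ∈ xs → y ∈ xs → f x ≡ f y → x ≡ y

    Collision : List A → Set
    Collision xs = ∃₂ λ x y → x ∈ xs × y ∈ xs × x ≢ y × f x ≡ f y

    injectiveOn-or-collision : DecidableEquality A → ∀ xs → InjectiveOn xs ⊎ Collision xs
    injectiveOn-or-collision _≟ᴬ_ xs with any? (λ x → any? (λ y → ¬? (x ≟ᴬ y) ×-dec (f x ≟ f y)) xs) xs
    ... | yes some = let x , x∈ , some-y = find some ; y , y∈ , x≢y , fx≡fy = find some-y
                     in inj₂ (x , y , x∈ , y∈ , x≢y , fx≡fy)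
    ... | no  none = inj₁ λ {x} {y} x∈ y∈ fx≡fy →
                     decidable-stable (x ≟ᴬ y) λ x≢y → none (lose x∈ (lose y∈ (x≢y , fx≡fy)))

    length≤-injectiveOn : ∀ M xs → Unique xs → All (λ x → f x < M) xs → InjectiveOn xs → length xs ≤ M
    length≤-injectiveOn M xs unique bound inj = subst (length xs ≤_) (*-identityʳ M)
      (length≤fibres M 1 xs bound λ i → filter-length≤1 _ unique
        λ (x∈ , fx≡i) (y∈ , fy≡i) → inj x∈ y∈ (trans fx≡i (sym fy≡i)))

    length≤-twoPerFibre : ∀ M xs → Unique xs → All (λ x → f x < M) xs →
                          (∀ i → AtMostTwo (λ x → x ∈ xs × f x ≡ i)) → length xs ≤ M * 2
    length≤-twoPerFibre M xs unique bound two =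
      length≤fibres M 2 xs bound λ i → filter-length≤2 _ unique (two i)

-- Shortest paths in P_m □ C_n

cycSucc : ∀ {n} (a : Fin n) → ∃ (CycSucc n a)
cycSucc {suc n} a with suc (toℕ a) <? suc n
... | yes a+1<n = fromℕ< a+1<n , inj₁ (sym (toℕ-fromℕ< a+1<n))
... | no  a+1≮n = Fin.zero , inj₂ (≤-antisym (toℕ<n a) (≮⇒≥ a+1≮n) , refl)

cycPred : ∀ {n} (a : Fin n) → ∃ λ c → CycSucc n c a
cycPred {suc n} Fin.zero    = fromℕ n , inj₂ (cong suc (toℕ-fromℕ n) , refl)
cycPred {suc n} (Fin.suc a) = inject₁ a , inj₁ (cong suc (toℕ-inject₁ a))

pathPred : ∀ {m} (i : Fin m) → 0 < toℕ i → ∃ λ (j : Fin m) → suc (toℕ j) ≡ toℕ i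
pathPred {suc m} (Fin.suc i) _ = inject₁ i , cong suc (toℕ-inject₁ i)

cycSucc-unique : ∀ {n} {a c₁ c₂ : Fin n} → CycSucc n a c₁ → CycSucc n a c₂ → c₁ ≡ c₂
cycSucc-unique {c₁ = c₁} {c₂} s₁ s₂ = toℕ-injective (succ-functional (toℕ<n c₁) (toℕ<n c₂) s₁ s₂)

cycPred-unique : ∀ {n} {a c₁ c₂ : Fin n} → CycSucc n c₁ a → CycSucc n c₂ a → c₁ ≡ c₂
cycPred-unique s₁ s₂ = toℕ-injective (succ-injective s₁ s₂)

cycleAdj-two-neighbours : ∀ {n} {a c₁ c₂ c : Fin n} → c₁ ≢ c₂ →
                          CycleAdj n a c₁ → CycleAdj n a c₂ → CycleAdj n a c → c ≡ c₁ ⊎ c ≡ c₂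
cycleAdj-two-neighbours c₁≢c₂ (inj₁ s₁) (inj₁ s₂) _ = contradiction (cycSucc-unique s₁ s₂) c₁≢c₂
cycleAdj-two-neighbours c₁≢c₂ (inj₂ p₁) (inj₂ p₂) _ = contradiction (cycPred-unique p₁ p₂) c₁≢c₂
cycleAdj-two-neighbours _ (inj₁ s₁) (inj₂ _)  (inj₁ s) = inj₁ (cycSucc-unique s s₁)
cycleAdj-two-neighbours _ (inj₁ _)  (inj₂ p₂) (inj₂ p) = inj₂ (cycPred-unique p p₂)
cycleAdj-two-neighbours _ (inj₂ p₁) (inj₁ _)  (inj₂ p) = inj₁ (cycPred-unique p p₁)
cycleAdj-two-neighbours _ (inj₂ _)  (inj₁ s₂) (inj₁ s) = inj₂ (cycSucc-unique s s₂)

module PathCycle (m n : ℕ) where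

  V : Set
  V = Fin m × Fin n

  _≟ᵥ_ : DecidableEquality V
  _≟ᵥ_ = ≡-dec Fin._≟_ Fin._≟_

  _~_ : V → V → Set
  _~_ = PCAdj m n

  distinct-coordinates⇒≁ : ∀ {i p a b} → i ≢ p → a ≢ b → ¬ (i , a) ~ (p , b)
  distinct-coordinates⇒≁ i≢p _   (inj₁ (i≡p , _)) = i≢p i≡p
  distinct-coordinates⇒≁ _   a≢b (inj₂ (_ , a≡b)) = a≢b a≡b

  ofs : Fin n → Fin n → ℕ
  ofs a b = offset n (toℕ a) (toℕ b)

  cycleDist : Fin n → Fin n → ℕ
  cycleDist a b = cyclicNorm n (ofs a b)

  pathDist : Fin m → Fin m → ℕ
  pathDist i p = ∣ toℕ i - toℕ p ∣

  dist : V → V → ℕ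
  dist (i , a) (p , b) = pathDist i p + cycleDist a b

  ofs<n : ∀ a b → ofs a b < n
  ofs<n a b = offset<n (toℕ<n a) (toℕ<n b)

  ofs-succ : ∀ {a c} → CycSucc n a c → ∀ b → Succ n (ofs c b) (ofs a b)
  ofs-succ {c = c} a→c b = offset-succˡ (toℕ<n c) (toℕ<n b) a→c

  cycleDist-adj : ∀ {a c} b → CycleAdj n a c → cycleDist a b ≤ suc (cycleDist c b)
  cycleDist-adj {a} b (inj₁ a→c) = cyclicNorm-succ≤ (ofs<n a b) (ofs-succ a→c b)
  cycleDist-adj {c = c} b (inj₂ c→a) = cyclicNorm-pred≤ (ofs<n c b) (ofs-succ c→a b)

  dist-adj : ∀ {u w} v → u ~ w → dist u v ≤ suc (dist w v)
  dist-adj {i , _} (p , b) (inj₁ (refl , a~c)) =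
    ≤-trans (+-monoʳ-≤ (pathDist i p) (cycleDist-adj b a~c)) (≤-reflexive (+-suc _ _))
  dist-adj {_ , a} (p , b) (inj₂ (i~j , refl)) = +-monoˡ-≤ (cycleDist a b) (∣-∣-consecutive (toℕ p) i~j)

  dist≤len : ∀ {u v} (q : Walk _~_ u v) → dist u v ≤ len _~_ q
  dist≤len {i , a} [ _ ] = ≤-reflexive (cong₂ _+_ (∣n-n∣≡0 (toℕ i)) (cong (cyclicNorm n) (offset-self n (toℕ a))))
  dist≤len {v = v} (step u~w q) = ≤-trans (dist-adj v u~w) (s≤s (dist≤len q))

  forward-closer⇔ : ∀ {a c} b → CycSucc n a c →
                    (cycleDist c b < cycleDist a b) ⇔ (0 < ofs a b × ofs a b ≤ n ∸ ofs a b)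
  forward-closer⇔ {a} b a→c = cyclicNorm-pred<⇔ (ofs<n a b) (ofs-succ a→c b)

  backward-closer⇔ : ∀ {a c} b → CycSucc n c a → (cycleDist c b < cycleDist a b) ⇔ (n ∸ ofs a b ≤ ofs a b)
  backward-closer⇔ {c = c} b c→a = cyclicNorm-succ<⇔ (ofs<n c b) (ofs-succ c→a b)

  closer-cycle-neighbour : ∀ {a b} → a ≢ b → ∃ λ c → CycleAdj n a c × cycleDist c b < cycleDist a b
  closer-cycle-neighbour {a} {b} a≢b with ofs a b ≤? n ∸ ofs a b
  ... | yes first-half = let c , a→c = cycSucc a in
    c , inj₁ a→c , Equivalence.from (forward-closer⇔ b a→c) (0<ofs , first-half)
    where 0<ofs = n≢0⇒n>0 λ eq → a≢b (toℕ-injective (offset≡0⇒≡ (toℕ<n a) (toℕ<n b) eq))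
  ... | no  ¬first-half = let c , c→a = cycPred a in
    c , inj₂ c→a , Equivalence.from (backward-closer⇔ b c→a) (<⇒≤ (≰⇒> ¬first-half))

  closer-path-neighbour : ∀ {i p} → i ≢ p → ∃ λ j → PathAdj m i j × pathDist j p < pathDist i p
  closer-path-neighbour {i} {p} i≢p with <-cmp (toℕ i) (toℕ p)
  ... | tri< i<p _ _ = let j = fromℕ< (≤-<-trans i<p (toℕ<n p)) ; i+1≡j = sym (toℕ-fromℕ< _) in
        j , inj₁ i+1≡j , subst (λ x → ∣ x - toℕ p ∣ < pathDist i p) i+1≡j (m<n⇒∣1+m-n∣<∣m-n∣ i<p)
  ... | tri≈ _ i≡p _ = contradiction (toℕ-injective i≡p) i≢p
  ... | tri> _ _ p<i = let j , j+1≡i = pathPred i (≤-<-trans z≤n p<i) in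
        j , inj₂ j+1≡i , subst (λ x → pathDist j p < ∣ x - toℕ p ∣) j+1≡i
                           (n≤m⇒∣m-n∣<∣1+m-n∣ (s≤s⁻¹ (subst (toℕ p <_) (sym j+1≡i) p<i)))

  closer-neighbour : ∀ {u v} → u ≢ v → ∃ λ w → u ~ w × dist w v < dist u v
  closer-neighbour {i , a} {p , b} u≢v with a Fin.≟ b
  ... | no a≢b = let c , a~c , closer = closer-cycle-neighbour a≢b in
                 (i , c) , inj₁ (refl , a~c) , +-monoʳ-< (pathDist i p) closer
  ... | yes refl = let j , i~j , closer = closer-path-neighbour (λ i≡p → u≢v (cong (_, a) i≡p)) in
                   (j , a) , inj₂ (i~j , refl) , +-monoˡ-< (cycleDist a a) closer

  walk-within : ∀ d u v → dist u v ≤ d → Σ (Walk _~_ u v) λ q → len _~_ q ≤ d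
  walk-within d u v _ with u ≟ᵥ v
  walk-within d u .u _ | yes refl = [ u ] , z≤n
  walk-within d u v u→v≤d | no u≢v with closer-neighbour u≢v
  walk-within zero    u v u→v≤0 | no _ | _ , _ , closer = contradiction (<-≤-trans closer u→v≤0) (λ ())
  walk-within (suc d) u v u→v≤d | no _ | w , u~w , closer =
    let q , q≤d = walk-within d w v (s≤s⁻¹ (<-≤-trans closer u→v≤d)) in step u~w q , s≤s q≤d

  shortest-step-closer : ∀ {u w v} (u~w : u ~ w) (q : Walk _~_ w v) →
                         IsShortest _~_ (step u~w q) → dist w v < dist u v
  shortest-step-closer {u} {v = v} _ q shortest =
    let r , r≤dist = walk-within (dist u v) u v ≤-refl in
    ≤-trans (s≤s (dist≤len q)) (≤-trans (shortest r) r≤dist)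

  record Exit (X : List V) (u v w : V) : Set where
    constructor exit
    field
      adjacent : u ~ w
      outside  : w ∉ X
      closer   : dist w v < dist u v

  exit-of-shortest : ∀ {X u v} (q : Walk _~_ u v) → IsShortest _~_ q → u ≢ v → ¬ u ~ v →
                     (∀ w → w ∈ interior _~_ q → w ∉ X) → ∃ λ w → w ∈ interior _~_ q × Exit X u v w
  exit-of-shortest [ _ ]                  _        u≢u _    _     = contradiction refl u≢u
  exit-of-shortest (step u~v [ _ ])       _        _   u≁v  _     = contradiction u~v u≁v
  exit-of-shortest (step u~w (step w~x q)) shortest _  _    avoid =
    _ , here refl , exit u~w (avoid _ (here refl)) (shortest-step-closer u~w (step w~x q) shortest)

  TwoExits : List V → V → V → Set
  TwoExits X u v = ∃₂ λ w₁ w₂ → w₁ ≢ w₂ × Exit X u v w₁ × Exit X u v w₂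

  two-exits : ∀ {k X u v} → IsFTMV _~_ (suc k) X → u ∈ X → v ∈ X → u ≢ v → ¬ u ~ v → TwoExits X u v
  two-exits {u = u} {v} ftmv u∈X v∈X u≢v u≁v =
    let Q , shortest , disjoint , avoid = ftmv u v u∈X v∈X u≢v u≁v
        w₁ , w₁∈Q₁ , exit₁ = exit-of-shortest (Q Fin.zero) (shortest _) u≢v u≁v (avoid _)
        w₂ , w₂∈Q₂ , exit₂ = exit-of-shortest (Q (Fin.suc Fin.zero)) (shortest _) u≢v u≁v (avoid _)
    in w₁ , w₂ , (λ w₁≡w₂ → disjoint _ _ (λ ()) w₁ w₁∈Q₁ (subst (_∈ _) (sym w₁≡w₂) w₂∈Q₂)) , exit₁ , exit₂

  Antipodal : Fin n → Fin n → Set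
  Antipodal a b = 2 * ofs a b ≡ n

  antipode-unique : ∀ {a b c} → Antipodal a b → Antipodal a c → b ≡ c
  antipode-unique {a} {b} {c} 2ab≡n 2ac≡n = toℕ-injective
    (offset-injective (toℕ<n a) (toℕ<n b) (toℕ<n c) (*-cancelˡ-≡ _ _ 2 (trans 2ab≡n (sym 2ac≡n))))

  closer-on-both-sides⇒antipodal : ∀ {a b c₁ c₂} → c₁ ≢ c₂ → CycleAdj n a c₁ → CycleAdj n a c₂ →
                                   cycleDist c₁ b < cycleDist a b → cycleDist c₂ b < cycleDist a b → Antipodal a b
  closer-on-both-sides⇒antipodal c₁≢c₂ (inj₁ s₁) (inj₁ s₂) _ _ = contradiction (cycSucc-unique s₁ s₂) c₁≢c₂
  closer-on-both-sides⇒antipodal c₁≢c₂ (inj₂ p₁) (inj₂ p₂) _ _ = contradiction (cycPred-unique p₁ p₂) c₁≢c₂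
  closer-on-both-sides⇒antipodal {a} {b} _ (inj₁ s) (inj₂ p) fwd bwd = halves⇒2*t≡n (<⇒≤ (ofs<n a b))
    (proj₂ (Equivalence.to (forward-closer⇔ b s) fwd)) (Equivalence.to (backward-closer⇔ b p) bwd)
  closer-on-both-sides⇒antipodal {a} {b} _ (inj₂ p) (inj₁ s) bwd fwd = halves⇒2*t≡n (<⇒≤ (ofs<n a b))
    (proj₂ (Equivalence.to (forward-closer⇔ b s) fwd)) (Equivalence.to (backward-closer⇔ b p) bwd)

  PathStepBlocked : List V → V → Fin m → Set
  PathStepBlocked X (i , a) p = ∀ {j} → PathAdj m i j → pathDist j p < pathDist i p → (j , a) ∈ X

  module _ {X : List V} {i : Fin m} {a : Fin n} {p : Fin m} {b : Fin n} where

    some-cycle-exit : TwoExits X (i , a) (p , b) →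
                      ∃ λ c → CycleAdj n a c × (i , c) ∉ X × cycleDist c b < cycleDist a b
    some-cycle-exit (_ , _ , _ , exit (inj₁ (refl , a~c)) out closer , _) =
      _ , a~c , out , +-cancelˡ-< (pathDist i p) _ _ closer
    some-cycle-exit (_ , _ , _ , _ , exit (inj₁ (refl , a~c)) out closer) =
      _ , a~c , out , +-cancelˡ-< (pathDist i p) _ _ closer
    some-cycle-exit (_ , _ , w₁≢w₂ , exit (inj₂ (i~j₁ , refl)) _ closer₁ , exit (inj₂ (i~j₂ , refl)) _ closer₂) =
      contradiction (cong (_, a) (toℕ-injective (consecutive-closer-unique (toℕ p) i~j₁ i~j₂
        (+-cancelʳ-< (cycleDist a b) _ _ closer₁) (+-cancelʳ-< (cycleDist a b) _ _ closer₂)))) w₁≢w₂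

    cycle-exit : ∀ {w} → PathStepBlocked X (i , a) p → Exit X (i , a) (p , b) w →
                 ∃ λ c → w ≡ (i , c) × CycleAdj n a c × cycleDist c b < cycleDist a b
    cycle-exit _       (exit (inj₁ (refl , a~c)) _ closer) = _ , refl , a~c , +-cancelˡ-< (pathDist i p) _ _ closer
    cycle-exit blocked (exit (inj₂ (i~j , refl)) out closer) =
      contradiction (blocked i~j (+-cancelʳ-< (cycleDist a b) _ _ closer)) out

    blocked⇒antipodal : TwoExits X (i , a) (p , b) → PathStepBlocked X (i , a) p →
                        Antipodal a b × (∀ {c} → CycleAdj n a c → (i , c) ∉ X)
    blocked⇒antipodal (w₁ , w₂ , w₁≢w₂ , exit₁ , exit₂) blocked
      with cycle-exit blocked exit₁ | cycle-exit blocked exit₂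
    ... | c₁ , refl , a~c₁ , closer₁ | c₂ , refl , a~c₂ , closer₂ =
      closer-on-both-sides⇒antipodal c₁≢c₂ a~c₁ a~c₂ closer₁ closer₂ , neighbours-outside
      where
      c₁≢c₂ : c₁ ≢ c₂
      c₁≢c₂ c₁≡c₂ = w₁≢w₂ (cong (i ,_) c₁≡c₂)
      neighbours-outside : ∀ {c} → CycleAdj n a c → (i , c) ∉ X
      neighbours-outside a~c with cycleAdj-two-neighbours c₁≢c₂ a~c₁ a~c₂ a~c
      ... | inj₁ refl = Exit.outside exit₁
      ... | inj₂ refl = Exit.outside exit₂

-- Fault-tolerant mutual-visibility sets

module FTMV {m n k : ℕ} {X : List (Fin m × Fin n)} (ftmv : IsFTMV (PCAdj m n) (suc k) X) where

  open PathCycle m n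

  column-pair-consecutive : ∀ {i j a} → (i , a) ∈ X → (j , a) ∈ X → i ≢ j → PathAdj m i j
  column-pair-consecutive {i} {j} {a} i∈X j∈X i≢j with consecutive? (toℕ i) (toℕ j)
  ... | yes i~j = i~j
  ... | no  i≁j =
    let c , _ , _ , closer = some-cycle-exit (two-exits ftmv i∈X j∈X (i≢j ∘ cong proj₁) non-adjacent)
    in contradiction (subst (cycleDist c a <_) (cong (cyclicNorm n) (offset-self n (toℕ a))) closer) n≮0
    where
    non-adjacent : ¬ (i , a) ~ (j , a)
    non-adjacent (inj₁ (i≡j , _)) = i≢j i≡j
    non-adjacent (inj₂ (i~j , _)) = i≁j i~j

  column-triple : ∀ {i j l a} → (i , a) ∈ X → (j , a) ∈ X → (l , a) ∈ X → i ≢ j → j ≢ l → i ≢ l → ⊥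
  column-triple i∈X j∈X l∈X i≢j j≢l i≢l = consecutive-triangle (column-pair-consecutive i∈X j∈X i≢j)
    (column-pair-consecutive j∈X l∈X j≢l) (column-pair-consecutive i∈X l∈X i≢l)

  row-pair : ∀ {i a b} → (i , a) ∈ X → (i , b) ∈ X → a ≢ b →
             CycleAdj n a b ⊎ (Antipodal a b × (∀ {c} → CycleAdj n a c → (i , c) ∉ X))
  row-pair {i} {a} {b} a∈X b∈X a≢b with cycAdj? n (toℕ a) (toℕ b)
  ... | yes a~b = inj₁ a~b
  ... | no  a≁b =
    inj₂ (blocked⇒antipodal (two-exits ftmv a∈X b∈X (a≢b ∘ cong proj₂) non-adjacent) no-path-step)
    where
    non-adjacent : ¬ (i , a) ~ (i , b)
    non-adjacent (inj₁ (_ , a~b))        = a≁b a~b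
    non-adjacent (inj₂ (i~i , _))        = consecutive-irrefl i~i
    no-path-step : PathStepBlocked X (i , a) i
    no-path-step {j} _ closer = contradiction (subst (pathDist j i <_) (∣n-n∣≡0 (toℕ i)) closer) n≮0

  row-triple : 4 ≤ n → ∀ {i a b c} → (i , a) ∈ X → (i , b) ∈ X → (i , c) ∈ X → a ≢ b → b ≢ c → a ≢ c → ⊥
  row-triple 4≤n {i} {a} {b} {c} a∈X b∈X c∈X a≢b b≢c a≢c
    with row-pair a∈X b∈X a≢b | row-pair a∈X c∈X a≢c
  ... | inj₂ (_ , outside) | inj₁ a~c = outside a~c c∈X
  ... | inj₁ a~b | inj₂ (_ , outside) = outside a~b b∈X
  ... | inj₂ (ab , _) | inj₂ (ac , _) = b≢c (antipode-unique {a} ab ac)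
  ... | inj₁ a~b | inj₁ a~c with row-pair b∈X c∈X b≢c
  ...   | inj₂ (_ , outside) = outside (cycAdj-sym a~b) a∈X
  ...   | inj₁ b~c = <⇒≱ 4≤n (cycAdj-triangle⇒n≤3 {n} (toℕ<n a) (toℕ<n b) (toℕ<n c) a~b b~c a~c)

  far-end-antipodal : ∀ {r r' p a b} → (r , a) ∈ X → (r' , a) ∈ X → PathAdj m r r' →
                      pathDist r' p < pathDist r p → (p , b) ∈ X → b ≢ a → Antipodal a b
  far-end-antipodal {r} {r'} {p} {a} {b} r∈X r'∈X r~r' r'-closer p∈X b≢a =
    proj₁ (blocked⇒antipodal exits blocked)
    where
    r≢p : r ≢ p
    r≢p refl = contradiction (subst (pathDist r' r <_) (∣n-n∣≡0 (toℕ r)) r'-closer) n≮0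
    exits : TwoExits X (r , a) (p , b)
    exits = two-exits ftmv r∈X p∈X (r≢p ∘ cong proj₁) (distinct-coordinates⇒≁ r≢p (b≢a ∘ sym))
    blocked : PathStepBlocked X (r , a) p
    blocked r~j j-closer
      rewrite toℕ-injective (consecutive-closer-unique (toℕ p) r~j r~r' j-closer r'-closer) = r'∈X

  column-pair-antipodal : ∀ {i j a p b} → (i , a) ∈ X → (j , a) ∈ X → i ≢ j → (p , b) ∈ X → b ≢ a → Antipodal a b
  column-pair-antipodal {p = p} i∈X j∈X i≢j p∈X b≢a
    with i~j ← column-pair-consecutive i∈X j∈X i≢j | consecutive-closer-or-farther (toℕ p) i~j
  ... | inj₁ j-closer = far-end-antipodal i∈X j∈X i~j j-closer p∈X b≢a
  ... | inj₂ i-closer = far-end-antipodal j∈X i∈X (consecutive-sym i~j) i-closer p∈X b≢a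

  odd-row-pair : n % 2 ≡ 1 → ∀ {i a a' p b} → (i , a) ∈ X → (i , a') ∈ X → CycSucc n a a' →
                 (p , b) ∈ X → p ≢ i → b ≢ a → b ≢ a' → suc (2 * ofs a' b) ≡ n
  odd-row-pair odd {i} {a} {a'} {p} {b} a∈X a'∈X a→a' p∈X p≢i b≢a b≢a' =
    odd-middle odd (<⇒≤ (ofs<n a' b)) first-half (subst (λ t → n ∸ t ≤ t) ofs-a≡1+ofs-a' second-half)
    where
    -- (i , a') blocks the forward cycle exit of (i , a), and (i , a) the backward one of (i , a').
    exits-from : ∀ {c} → (i , c) ∈ X → b ≢ c → TwoExits X (i , c) (p , b)
    exits-from c∈X b≢c =
      two-exits ftmv c∈X p∈X (p≢i ∘ sym ∘ cong proj₁) (distinct-coordinates⇒≁ (p≢i ∘ sym) (b≢c ∘ sym))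

    second-half : n ∸ ofs a b ≤ ofs a b
    second-half with some-cycle-exit (exits-from a∈X b≢a)
    ... | _ , inj₁ a→c , c∉X , _      = contradiction (subst (λ c → (i , c) ∈ X) (cycSucc-unique a→a' a→c) a'∈X)
                                                        c∉X
    ... | _ , inj₂ c→a , _   , closer = Equivalence.to (backward-closer⇔ b c→a) closer

    first-half : ofs a' b ≤ n ∸ ofs a' b
    first-half with some-cycle-exit (exits-from a'∈X b≢a')
    ... | _ , inj₂ c→a' , c∉X , _      = contradiction (subst (λ c → (i , c) ∈ X) (cycPred-unique a→a' c→a') a∈X)
                                                         c∉X
    ... | _ , inj₁ a'→c , _   , closer = proj₂ (Equivalence.to (forward-closer⇔ b a'→c) closer)

    ofs-a≡1+ofs-a' : ofs a b ≡ suc (ofs a' b)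
    ofs-a≡1+ofs-a' with ofs-succ a→a' b
    ... | inj₁ 1+ofs-a'≡ofs-a = sym 1+ofs-a'≡ofs-a
    ... | inj₂ (_ , ofs-a≡0)  = contradiction (sym (toℕ-injective (offset≡0⇒≡ (toℕ<n a) (toℕ<n b) ofs-a≡0))) b≢a

  row col : V → ℕ
  row = toℕ ∘ proj₁
  col = toℕ ∘ proj₂

  column-atMostTwo : ∀ c → AtMostTwo (λ x → x ∈ X × col x ≡ c)
  column-atMostTwo _ {i , a} {j , _} {l , _} (i∈X , refl) (j∈X , b≡a) (l∈X , d≡a) x≢y y≢z x≢z
    with refl ← toℕ-injective b≡a | refl ← toℕ-injective d≡a =
    column-triple i∈X j∈X l∈X (x≢y ∘ cong (_, a)) (y≢z ∘ cong (_, a)) (x≢z ∘ cong (_, a))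

  row-atMostTwo : 4 ≤ n → ∀ r → AtMostTwo (λ x → x ∈ X × row x ≡ r)
  row-atMostTwo 4≤n _ {i , a} {_ , b} {_ , c} (a∈X , refl) (b∈X , j≡i) (c∈X , l≡i) x≢y y≢z x≢z
    with refl ← toℕ-injective j≡i | refl ← toℕ-injective l≡i =
    row-triple 4≤n a∈X b∈X c∈X (x≢y ∘ cong (i ,_)) (y≢z ∘ cong (i ,_)) (x≢z ∘ cong (i ,_))

  module Bounds (4≤n : 4 ≤ n) (unique : Unique X) where

    rows<m : All (λ x → row x < m) X
    rows<m = All.tabulate λ {x} _ → toℕ<n (proj₁ x)

    cols<n : All (λ x → col x < n) X
    cols<n = All.tabulate λ {x} _ → toℕ<n (proj₂ x)

    length≤2m : length X ≤ 2 * m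
    length≤2m = subst (length X ≤_) (*-comm m 2) (length≤-twoPerFibre row m X unique rows<m (row-atMostTwo 4≤n))

    column-pair⇒length≤4 : ∀ {i j a} → (i , a) ∈ X → (j , a) ∈ X → i ≢ j → length X ≤ 4
    column-pair⇒length≤4 {i} {j} {a} i∈X j∈X i≢j =
      length≤-split in-column? X (filter-length≤2 in-column? unique (column-atMostTwo (toℕ a)))
                                 (filter-length≤2 (∁? in-column?) unique antipodal-column)
      where
      in-column? = λ x → col x ≟ toℕ a
      antipodal : ∀ {q b} → (q , b) ∈ X → toℕ b ≢ toℕ a → Antipodal a b
      antipodal q∈X b≢a = column-pair-antipodal i∈X j∈X i≢j q∈X (b≢a ∘ cong toℕ)
      antipodal-column : AtMostTwo (λ x → x ∈ X × toℕ (proj₂ x) ≢ toℕ a)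
      antipodal-column {p , b} {q , c} {r , d} (p∈X , b≢a) (q∈X , c≢a) (r∈X , d≢a) x≢y y≢z x≢z
        with refl ← antipode-unique {a} (antipodal p∈X b≢a) (antipodal q∈X c≢a)
           | refl ← antipode-unique {a} (antipodal p∈X b≢a) (antipodal r∈X d≢a) =
        column-triple p∈X q∈X r∈X (x≢y ∘ cong (_, b)) (y≢z ∘ cong (_, b)) (x≢z ∘ cong (_, b))

    length≤n : length X ≤ n
    length≤n with injectiveOn-or-collision col _≟ᵥ_ X
    ... | inj₁ col-injective = length≤-injectiveOn col n X unique cols<n col-injective
    ... | inj₂ ((i , a) , (j , b) , x∈X , y∈X , x≢y , a≡b) with refl ← toℕ-injective a≡b =
      ≤-trans (column-pair⇒length≤4 x∈X y∈X (x≢y ∘ cong (_, a))) 4≤n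

    row-adjacent-pair⇒length≤3 : n % 2 ≡ 1 → InjectiveOn col X → ∀ {i a a'} →
                                 (i , a) ∈ X → (i , a') ∈ X → CycSucc n a a' → length X ≤ 3
    row-adjacent-pair⇒length≤3 odd col-injective {i} {a} {a'} a∈X a'∈X a→a' =
      length≤-split in-pair? X (filter-length≤2 in-pair? unique atMostTwo-pair)
                               (filter-length≤1 (∁? in-pair?) unique others-equal)
      where
      in-pair? = λ x → (x ≟ᵥ (i , a)) ⊎-dec (x ≟ᵥ (i , a'))
      a≢a' : a ≢ a'
      a≢a' refl = <⇒≱ 4≤n (≤-trans (succ-irreflexive a→a') (s≤s z≤n))
      middle : ∀ {x} → x ∈ X → ¬ (x ≡ (i , a) ⊎ x ≡ (i , a')) → suc (2 * ofs a' (proj₂ x)) ≡ n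
      middle {p , b} p∈X not-pair = odd-row-pair odd a∈X a'∈X a→a' p∈X p≢i b≢a b≢a'
        where
        b≢a : b ≢ a
        b≢a refl = not-pair (inj₁ (col-injective p∈X a∈X refl))
        b≢a' : b ≢ a'
        b≢a' refl = not-pair (inj₂ (col-injective p∈X a'∈X refl))
        p≢i : p ≢ i
        p≢i refl = row-triple 4≤n a∈X a'∈X p∈X a≢a' (b≢a' ∘ sym) (b≢a ∘ sym)
      others-equal : ∀ {x y} → x ∈ X × ¬ _ → y ∈ X × ¬ _ → x ≡ y
      others-equal {x} {y} (x∈X , x∉pair) (y∈X , y∉pair) = col-injective x∈X y∈X (cong toℕ
        (toℕ-injective (offset-injective (toℕ<n a') (toℕ<n (proj₂ x)) (toℕ<n (proj₂ y))
          (*-cancelˡ-≡ _ _ 2 (suc-injective (trans (middle x∈X x∉pair) (sym (middle y∈X y∉pair))))))))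

    odd-column-pair⇒length≤2 : n % 2 ≡ 1 → ∀ {i j a} → (i , a) ∈ X → (j , a) ∈ X → i ≢ j → length X ≤ 2
    odd-column-pair⇒length≤2 odd {a = a} i∈X j∈X i≢j =
      length≤2 unique (All.tabulate (λ z∈X → z∈X , in-column z∈X)) (column-atMostTwo (toℕ a))
      where
      in-column : ∀ {z} → z ∈ X → col z ≡ toℕ a
      in-column {p , c} p∈X with c Fin.≟ a
      ... | yes refl = refl
      ... | no  c≢a  = contradiction (column-pair-antipodal i∈X j∈X i≢j p∈X c≢a) (odd⇒2*m≢n (ofs a c) odd)

    odd-row-pair⇒length≤3 : n % 2 ≡ 1 → InjectiveOn col X → ∀ {i a b} →
                            (i , a) ∈ X → (i , b) ∈ X → a ≢ b → length X ≤ 3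
    odd-row-pair⇒length≤3 odd col-injective {a = a} {b} a∈X b∈X a≢b with row-pair a∈X b∈X a≢b
    ... | inj₂ (antipodal , _) = contradiction antipodal (odd⇒2*m≢n (ofs a b) odd)
    ... | inj₁ (inj₁ a→b)      = row-adjacent-pair⇒length≤3 odd col-injective a∈X b∈X a→b
    ... | inj₁ (inj₂ b→a)      = row-adjacent-pair⇒length≤3 odd col-injective b∈X a∈X b→a

    length≤3⊔[m⊓n] : n % 2 ≡ 1 → length X ≤ 3 ⊔ (m ⊓ n)
    length≤3⊔[m⊓n] odd with injectiveOn-or-collision col _≟ᵥ_ X | injectiveOn-or-collision row _≟ᵥ_ X
    ... | inj₂ ((i , a) , (j , b) , x∈X , y∈X , x≢y , a≡b) | _ with refl ← toℕ-injective a≡b =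
      ≤-trans (odd-column-pair⇒length≤2 odd x∈X y∈X (x≢y ∘ cong (_, a))) (≤-trans (n≤1+n 2) (m≤m⊔n 3 (m ⊓ n)))
    ... | inj₁ col-injective | inj₂ ((i , a) , (j , b) , x∈X , y∈X , x≢y , i≡j) with refl ← toℕ-injective i≡j =
      ≤-trans (odd-row-pair⇒length≤3 odd col-injective x∈X y∈X (x≢y ∘ cong (i ,_))) (m≤m⊔n 3 (m ⊓ n))
    ... | inj₁ col-injective | inj₁ row-injective =
      ≤-trans (⊓-glb (length≤-injectiveOn row m X unique rows<m row-injective)
                     (length≤-injectiveOn col n X unique cols<n col-injective))
              (m≤n⊔m 3 (m ⊓ n))

lemma6p2 : (m n k : ℕ) → 2 ≤ m → 4 ≤ n → 1 ≤ k →
    (X : List (Fin m × Fin n)) → Unique X → IsFTMV (PCAdj m n) k X →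
    (n % 2 ≡ 0 → length X ≤ (2 * m) ⊓ n) ×
    (n % 2 ≡ 1 → length X ≤ 3 ⊔ (m ⊓ n))
lemma6p2 _ _ zero    _ _   () _ _      _
lemma6p2 m n (suc k) _ 4≤n _  X unique ftmv =
  (λ _ → ⊓-glb length≤2m length≤n) , length≤3⊔[m⊓n]
  where
  open FTMV ftmv
  open Bounds 4≤n unique
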